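{- Let $S$ be a twisted agreeable semigroup, regarded as a restriction semigroup with $D(s):=s*s$. For any filter $F$ of $D(S)$ and any $x,y\in S$: $x,y\in S\setminus W_F$ and $x\mathrel{\epsilon_F} y$ if and only if $x*y\in F$.
   Context: A twisted agreeable semigroup is a semigroup $S$ with a binary operation $*$ satisfying, for all $s,t,u,v\in S$: $(s*s)s=s$; $s*t=t*s$; $(s*t)s=(s*t)t$; $((u*v)s)*t=(s*t)(u*v)$; $u(s*t)=(us*ut)u$. Setting $D(s):=s*s$ makes $S$ a restriction semigroup (i.e. $D(s)s=s$, $D(st)=D(s)D(st)$, $D(s)D(t)=D(t)D(s)$, $D(D(s))=D(s)$, $sD(t)=D(st)s$). $D(S)=\{D(s)\mid s\in S\}$ is a semilattice, ordered by $\mathsf e\le\mathsf f$ iff $\mathsf e=\mathsf e\mathsf f$. A filter of $D(S)$ is a subset closed under multiplication and upward closed in $D(S)$. For a filter $F$: $W_F=\{a\in S\mid D(a)\notin F\}$, and $a\mathrel{\epsilon_F}b$ iff $\mathsf e a=\mathsf e b$ for some $\mathsf e\in F$. -}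

module Defs where

open import Level using (Level; suc; _⊔_)
open import Data.Product using (Σ; ∃; _×_; _,_)
open import Relation.Nullary using (¬_)
open import Relation.Binary.PropositionalEquality using (_≡_)

record TwistedAgreeableSemigroup (ℓ : Level) : Set (suc ℓ) where
  infixl 7 _·_
  infixl 6 _*_
  field
    Carrier : Set ℓ
    _·_     : Carrier → Carrier → Carrier
    _*_     : Carrier → Carrier → Carrier
    ·-assoc : ∀ s t u → (s · t) · u ≡ s · (t · u)
    ax1 : ∀ s → (s * s) · s ≡ s
    ax2 : ∀ s t → s * t ≡ t * s
    ax3 : ∀ s t → (s * t) · s ≡ (s * t) · t
    ax4 : ∀ s t u v → ((u * v) · s) * t ≡ (s * t) · (u * v)
    ax5 : ∀ s t u → u · (s * t) ≡ ((u · s) * (u · t)) · u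

  D : Carrier → Carrier
  D s = s * s

  InD : Carrier → Set ℓ
  InD e = ∃ λ s → e ≡ D s

  _≤D_ : Carrier → Carrier → Set ℓ
  e ≤D f = e ≡ e · f

  record IsFilter {p : Level} (F : Carrier → Set p) : Set (ℓ ⊔ p) where
    field
      ⊆D      : ∀ {e} → F e → InD e
      ·-closed : ∀ {e f} → F e → F f → F (e · f)
      up-closed : ∀ {e f} → F e → InD f → e ≤D f → F f

  W : {p : Level} → (Carrier → Set p) → Carrier → Set p
  W F a = ¬ F (D a)

  -- membership in S \ W_F, i.e. D(a) ∈ F (stated positively)
  InComplW : {p : Level} → (Carrier → Set p) → Carrier → Set p
  InComplW F a = F (D a)

  ε : {p : Level} → (Carrier → Set p) → Carrier → Carrier → Set (ℓ ⊔ p)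
  ε F a b = Σ Carrier λ e → F e × (e · a ≡ e · b)

-- The element x * y of D(S) lies below D x and D y, and it witnesses x ε_F y by
-- the axiom (s * t) s = (s * t) t; so x * y ∈ F forces the left-hand side by
-- upward closure. Conversely, if e x = e y with e ∈ F, the axiom
-- u (s * t) = (u s * u t) u gives e (x * y) = e D(x), so e D(x) ∈ F lies below
-- x * y, which is therefore in F.
module Submission where

open import Defs
open import Level using (Level)
open import Data.Product using (_×_; _,_)
open import Function.Bundles using (_⇔_; mk⇔)
open import Relation.Binary.PropositionalEquality

module TwistedAgreeableProperties {ℓ : Level} (S : TwistedAgreeableSemigroup ℓ) where
  open TwistedAgreeableSemigroup S
  open ≡-Reasoning

  *≤Dˡ : ∀ s t → (s * t) ≤D D s
  *≤Dˡ s t = begin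
      s * t                ≡⟨ cong (_* t) (sym (ax1 s)) ⟩
      (D s · s) * t        ≡⟨ ax4 s t s s ⟩
      (s * t) · D s        ∎

  *≤Dʳ : ∀ s t → (s * t) ≤D D t
  *≤Dʳ s t = begin
      s * t                ≡⟨ ax2 s t ⟩
      t * s                ≡⟨ *≤Dˡ t s ⟩
      (t * s) · D t        ≡⟨ cong (_· D t) (ax2 t s) ⟩
      (s * t) · D t        ∎

  D·-absorbs-* : ∀ s t → D s · (s * t) ≡ s * t
  D·-absorbs-* s t = begin
      D s · (s * t)                    ≡⟨ ax5 s t (D s) ⟩
      ((D s · s) * (D s · t)) · D s    ≡⟨ cong (λ w → (w * (D s · t)) · D s) (ax1 s) ⟩
      (s * (D s · t)) · D s            ≡⟨ cong (_· D s) (ax2 s (D s · t)) ⟩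
      ((D s · t) * s) · D s            ≡⟨ cong (_· D s) (ax4 t s s s) ⟩
      ((t * s) · D s) · D s            ≡⟨ cong (λ w → (w · D s) · D s) (ax2 t s) ⟩
      ((s * t) · D s) · D s            ≡⟨ cong (_· D s) (sym (*≤Dˡ s t)) ⟩
      (s * t) · D s                    ≡⟨ sym (*≤Dˡ s t) ⟩
      s * t                            ∎

  *-idem : ∀ s t → (s * t) · (s * t) ≡ s * t
  *-idem s t = begin
      (s * t) · (s * t)        ≡⟨ sym (ax4 s t s t) ⟩
      ((s * t) · s) * t        ≡⟨ cong (_* t) (ax3 s t) ⟩
      ((s * t) · t) * t        ≡⟨ ax4 t t s t ⟩
      D t · (s * t)            ≡⟨ cong (D t ·_) (ax2 s t) ⟩
      D t · (t * s)            ≡⟨ D·-absorbs-* t s ⟩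
      t * s                    ≡⟨ ax2 t s ⟩
      s * t                    ∎

  *∈D : ∀ s t → InD (s * t)
  *∈D s t = z , sym (begin
      z * z                       ≡⟨ ax4 s z s t ⟩
      (s * z) · (s * t)           ≡⟨ cong (_· (s * t)) (ax2 s z) ⟩
      (z * s) · (s * t)           ≡⟨ cong (_· (s * t)) (ax4 s s s t) ⟩
      (D s · (s * t)) · (s * t)   ≡⟨ cong (_· (s * t)) (D·-absorbs-* s t) ⟩
      (s * t) · (s * t)           ≡⟨ *-idem s t ⟩
      s * t                       ∎)
    where z = (s * t) · s

  ·-*-agree : ∀ {e s t} → e · s ≡ e · t → e · (s * t) ≡ e · D s
  ·-*-agree {e} {s} {t} es≡et = begin
      e · (s * t)                 ≡⟨ ax5 s t e ⟩
      ((e · s) * (e · t)) · e     ≡⟨ cong (λ w → ((e · s) * w) · e) (sym es≡et) ⟩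
      ((e · s) * (e · s)) · e     ≡⟨ sym (ax5 s s e) ⟩
      e · D s                     ∎

  ·D≤D* : ∀ {e s t} → e · s ≡ e · t → (e · D s) ≤D (s * t)
  ·D≤D* {e} {s} {t} es≡et = sym (begin
      (e · D s) · (s * t)    ≡⟨ ·-assoc e (D s) (s * t) ⟩
      e · (D s · (s * t))    ≡⟨ cong (e ·_) (D·-absorbs-* s t) ⟩
      e · (s * t)            ≡⟨ ·-*-agree es≡et ⟩
      e · D s                ∎)

lemma2p11 : {ℓ p : Level} (S : TwistedAgreeableSemigroup ℓ) →
    let open TwistedAgreeableSemigroup S in
    (F : Carrier → Set p) → IsFilter F →
    (x y : Carrier) →
    (InComplW F x × InComplW F y × ε F x y) ⇔ F (x * y)
lemma2p11 S F isFilter x y = mk⇔ to from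
  where
    open TwistedAgreeableSemigroup S
    open IsFilter isFilter
    open TwistedAgreeableProperties S

    to : InComplW F x × InComplW F y × ε F x y → F (x * y)
    to (FDx , _ , e , Fe , ex≡ey) = up-closed (·-closed Fe FDx) (*∈D x y) (·D≤D* ex≡ey)

    from : F (x * y) → InComplW F x × InComplW F y × ε F x y
    from Fx*y = up-closed Fx*y (x , refl) (*≤Dˡ x y)
              , up-closed Fx*y (y , refl) (*≤Dʳ x y)
              , (x * y , Fx*y , ax3 x y)
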